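{- Suppose that a graph $G$ is competitively tight, and let $t$ be an integer such that $0 \leq t \leq k(G)$. Then the graph $G \cup I_t$ is competitively tight.
   Context: All graphs are finite, simple and undirected. $I_t$ denotes the edgeless graph on $t$ vertices and $G\cup I_t$ the disjoint union. The competition graph $C(D)$ of a digraph $D$ is the graph with vertex set $V(D)$ in which distinct $x,y$ are adjacent iff there is a vertex $v$ with $(x,v),(y,v)$ both arcs of $D$. The competition number $k(G)$ is the minimum integer $k\ge 0$ such that $G$ together with $k$ new isolated vertices is the competition graph of an acyclic digraph. An edge clique cover of $G$ is a family of cliques such that each edge has both endpoints in some clique of the family; $\theta_E(G)$ is its minimum size. $G$ is competitively tight if $k(G)=\theta_E(G)-|V(G)|+2$. -}

module Defs where

open import Data.Nat using (ℕ; _+_; _≤_)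
open import Data.Fin using (Fin; splitAt)
open import Data.Bool using (Bool; true; false)
open import Data.Sum using (_⊎_; inj₁; inj₂)
open import Data.Product using (Σ; ∃; _×_; _,_)
open import Data.List using (List; length)
open import Data.List.Relation.Unary.All using (All)
open import Data.List.Relation.Unary.Any using (Any)
open import Relation.Binary.PropositionalEquality using (_≡_; _≢_; refl)
open import Relation.Binary.Construct.Closure.Transitive using (TransClosure)
open import Relation.Nullary using (¬_)
open import Function.Bundles using (_⇔_)

record Graph (n : ℕ) : Set where
  field
    adj    : Fin n → Fin n → Bool
    sym    : ∀ i j → adj i j ≡ adj j i
    irrefl : ∀ i → adj i i ≡ false
open Graph public

Adj : ∀ {n} → Graph n → Fin n → Fin n → Set
Adj G i j = adj G i j ≡ true

-- Disjoint union G ∪ I_t: vertices of G are Fin n embedded first, the t new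
-- isolated vertices come after.
private
  adj⊎ : ∀ {n t} → (Fin n → Fin n → Bool) → Fin n ⊎ Fin t → Fin n ⊎ Fin t → Bool
  adj⊎ a (inj₁ x) (inj₁ y) = a x y
  adj⊎ a (inj₁ x) (inj₂ y) = false
  adj⊎ a (inj₂ x) (inj₁ y) = false
  adj⊎ a (inj₂ x) (inj₂ y) = false

  sym⊎ : ∀ {n t} (G : Graph n) (u v : Fin n ⊎ Fin t) →
         adj⊎ (adj G) u v ≡ adj⊎ (adj G) v u
  sym⊎ G (inj₁ x) (inj₁ y) = sym G x y
  sym⊎ G (inj₁ x) (inj₂ y) = refl
  sym⊎ G (inj₂ x) (inj₁ y) = refl
  sym⊎ G (inj₂ x) (inj₂ y) = refl

  irr⊎ : ∀ {n t} (G : Graph n) (u : Fin n ⊎ Fin t) → adj⊎ (adj G) u u ≡ false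
  irr⊎ G (inj₁ x) = irrefl G x
  irr⊎ G (inj₂ x) = refl

_∪I_ : ∀ {n} → Graph n → (t : ℕ) → Graph (n + t)
_∪I_ {n} G t = record
  { adj    = λ i j → adj⊎ (adj G) (splitAt n i) (splitAt n j)
  ; sym    = λ i j → sym⊎ G (splitAt n i) (splitAt n j)
  ; irrefl = λ i → irr⊎ G (splitAt n i)
  }

Digraph : ℕ → Set₁
Digraph m = Fin m → Fin m → Set

Acyclic : ∀ {m} → Digraph m → Set
Acyclic D = ∀ x → ¬ TransClosure D x x

IsCompetitionGraphOf : ∀ {m} → Graph m → Digraph m → Set
IsCompetitionGraphOf H D =
  ∀ x y → x ≢ y → (Adj H x y ⇔ ∃ λ v → D x v × D y v)

IsCompGraphOfAcyclic : ∀ {m} → Graph m → Set₁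
IsCompGraphOfAcyclic {m} H = Σ (Digraph m) λ D → Acyclic D × IsCompetitionGraphOf H D

IsCompetitionNumber : ∀ {n} → Graph n → ℕ → Set₁
IsCompetitionNumber G k =
  IsCompGraphOfAcyclic (G ∪I k) × (∀ k' → IsCompGraphOfAcyclic (G ∪I k') → k ≤ k')

IsClique : ∀ {n} → Graph n → (Fin n → Bool) → Set
IsClique G C = ∀ i j → i ≢ j → C i ≡ true → C j ≡ true → Adj G i j

IsEdgeCliqueCover : ∀ {n} → Graph n → List (Fin n → Bool) → Set
IsEdgeCliqueCover G F =
  All (IsClique G) F × (∀ i j → Adj G i j → Any (λ C → C i ≡ true × C j ≡ true) F)

IsEdgeCliqueCoverNumber : ∀ {n} → Graph n → ℕ → Set
IsEdgeCliqueCoverNumber G θ =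
  (Σ (List _) λ F → IsEdgeCliqueCover G F × length F ≡ θ) ×
  (∀ F → IsEdgeCliqueCover G F → θ ≤ length F)

-- Competitively tight: k(G) = θ_E(G) - |V(G)| + 2, written as k(G) + |V(G)| = θ_E(G) + 2.
CompetitivelyTight : ∀ {n} → Graph n → Set₁
CompetitivelyTight {n} G =
  Σ ℕ λ k → Σ ℕ λ θ →
    IsCompetitionNumber G k × IsEdgeCliqueCoverNumber G θ × (k + n ≡ θ + 2)

module Submission where

--   * θ_E(G ∪ I_t) = θ_E(G): cliques of G extend to G ∪ I_t by declaring the
--     new vertices absent, cliques of G ∪ I_t restrict along G ↪ G ∪ I_t, and
--     the new vertices carry no edges, so both operations send edge clique
--     covers to edge clique covers of the same length.
--   * k(G ∪ I_t) = k − t: the graphs (G ∪ I_t) ∪ I_s and G ∪ I_(t+s) are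
--     isomorphic, and being the competition graph of an acyclic digraph is
--     invariant under graph isomorphism; so G ∪ I_t needs s extra isolated
--     vertices exactly when G needs t + s of them.

open import Defs hiding (sym)
open import Level using (0ℓ)
open import Data.Nat using (ℕ; _≤_; _+_; _∸_)
open import Data.Nat.Properties
  using (≤-antisym; m+[n∸m]≡n; m∸n+n≡m; m+n∸m≡n; ∸-monoˡ-≤; +-comm; +-assoc)
open import Data.Fin using (Fin; splitAt; join; _↑ˡ_)
open import Data.Fin.Properties using (+↔⊎; splitAt-join; splitAt-↑ˡ; splitAt⁻¹-↑ˡ; ↑ˡ-injective)
open import Data.Bool using (Bool; true; false)
open import Data.Maybe using (Maybe; just; nothing; _>>=_)
open import Data.Sum using (inj₁; inj₂; [_,_]′)
open import Data.Sum.Algebra using (⊎-cong; ⊎-assoc)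
open import Data.Product using (∃; ∃₂; _×_; _,_)
open import Data.List using (map)
open import Data.List.Properties using (length-map)
import Data.List.Relation.Unary.All as All
import Data.List.Relation.Unary.All.Properties as All
import Data.List.Relation.Unary.Any as Any
import Data.List.Relation.Unary.Any.Properties as Any
open import Relation.Binary.PropositionalEquality
open import Relation.Binary.Construct.Closure.Transitive using (TransClosure; [_]; _∷_)
open import Function using (const; _∘_)
open import Function.Bundles using (_↔_; Inverse; _⇔_; mk⇔; Equivalence)
open import Function.Properties.Inverse using (↔-refl; ↔-sym; ↔-trans)

private
  variable
    n m m′ t k : ℕ

infix 4 _≅_
record _≅_ (H : Graph m) (H′ : Graph m′) : Set where
  field
    bij     : Fin m ↔ Fin m′
    adj-bij : ∀ x y → adj H′ (Inverse.to bij x) (Inverse.to bij y) ≡ adj H x y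

≅-sym : {H : Graph m} {H′ : Graph m′} → H ≅ H′ → H′ ≅ H
≅-sym {H = H} {H′} φ = record { bij = ↔-sym bij ; adj-bij = adj-from }
  where
  open _≅_ φ
  open Inverse bij
  adj-from : ∀ x y → adj H (from x) (from y) ≡ adj H′ x y
  adj-from x y = begin
    adj H (from x) (from y)               ≡⟨ sym (adj-bij (from x) (from y)) ⟩
    adj H′ (to (from x)) (to (from y))    ≡⟨ cong₂ (adj H′) (strictlyInverseˡ x) (strictlyInverseˡ y) ⟩
    adj H′ x y                            ∎
    where open ≡-Reasoning

compGraph-≅ : {H : Graph m} {H′ : Graph m′} →
              H ≅ H′ → IsCompGraphOfAcyclic H → IsCompGraphOfAcyclic H′
compGraph-≅ {H = H} {H′} φ (D , acyclic , competition) = D′ , acyclic′ , competition′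
  where
  open _≅_ φ
  open Inverse bij

  D′ : Digraph _
  D′ x y = D (from x) (from y)

  walk : ∀ {x y} → TransClosure D′ x y → TransClosure D (from x) (from y)
  walk [ a ]    = [ a ]
  walk (a ∷ as) = a ∷ walk as

  acyclic′ : Acyclic D′
  acyclic′ x cycle = acyclic (from x) (walk cycle)

  from-injective : ∀ {x y} → from x ≡ from y → x ≡ y
  from-injective {x} {y} e = trans (sym (strictlyInverseˡ x)) (trans (cong to e) (strictlyInverseˡ y))

  competition′ : IsCompetitionGraphOf H′ D′
  competition′ x y x≢y = mk⇔ prey⇒ ⇒adj
    where
    inD : Adj H (from x) (from y) ⇔ ∃ λ w → D (from x) w × D (from y) w
    inD = competition (from x) (from y) (x≢y ∘ from-injective)

    adj-from : adj H (from x) (from y) ≡ adj H′ x y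
    adj-from = _≅_.adj-bij (≅-sym φ) x y

    prey⇒ : Adj H′ x y → ∃ λ v → D′ x v × D′ y v
    prey⇒ a with Equivalence.to inD (trans adj-from a)
    ... | w , dx , dy =
      to w , subst (D (from x)) (sym (strictlyInverseʳ w)) dx
           , subst (D (from y)) (sym (strictlyInverseʳ w)) dy

    ⇒adj : (∃ λ v → D′ x v × D′ y v) → Adj H′ x y
    ⇒adj (v , dx , dy) = trans (sym adj-from) (Equivalence.from inD (from v , dx , dy))

adjᴹ : Graph n → Maybe (Fin n) → Maybe (Fin n) → Bool
adjᴹ G (just x) (just y) = adj G x y
adjᴹ G _        _        = false

adjᴹ-isolated : (G : Graph n) (a : Maybe (Fin n)) → adjᴹ G a nothing ≡ false
adjᴹ-isolated G (just x) = refl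
adjᴹ-isolated G nothing  = refl

old : ∀ n {t} → Fin (n + t) → Maybe (Fin n)
old n i = [ just , const nothing ]′ (splitAt n i)

adj-∪I : (G : Graph n) (t : ℕ) (i j : Fin (n + t)) →
         adj (G ∪I t) i j ≡ adjᴹ G (old n i) (old n j)
adj-∪I {n} G t i j with splitAt n i | splitAt n j
... | inj₁ x | inj₁ y = refl
... | inj₁ x | inj₂ y = refl
... | inj₂ x | inj₁ y = refl
... | inj₂ x | inj₂ y = refl

adjᴹ-∪I : (G : Graph n) (t : ℕ) (a b : Maybe (Fin (n + t))) →
          adjᴹ (G ∪I t) a b ≡ adjᴹ G (a >>= old n) (b >>= old n)
adjᴹ-∪I G t (just i) (just j) = adj-∪I G t i j
adjᴹ-∪I G t (just i) nothing  = sym (adjᴹ-isolated G (old _ i))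
adjᴹ-∪I G t nothing  _        = refl

old-↑ˡ : ∀ n {t} (x : Fin n) → old n {t} (x ↑ˡ t) ≡ just x
old-↑ˡ n {t} x = cong [ just , const nothing ]′ (splitAt-↑ˡ n x t)

assoc↔ : Fin ((n + t) + k) ↔ Fin (n + (t + k))
assoc↔ {n} {t} {k} =
  ↔-trans +↔⊎ (↔-trans (⊎-cong +↔⊎ ↔-refl)
    (↔-trans (⊎-assoc 0ℓ (Fin n) (Fin t) (Fin k))
      (↔-trans (⊎-cong ↔-refl (↔-sym +↔⊎)) (↔-sym +↔⊎))))

old-assoc : ∀ n t k (x : Fin ((n + t) + k)) →
            old n (Inverse.to (assoc↔ {n} {t} {k}) x) ≡ (old (n + t) x >>= old n)
old-assoc n t k x with splitAt (n + t) x
... | inj₂ w = cong [ just , const nothing ]′ (splitAt-join n (t + k) (inj₂ (join t k (inj₂ w))))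
... | inj₁ u with splitAt n u
...   | inj₁ v = cong [ just , const nothing ]′ (splitAt-join n (t + k) (inj₁ v))
...   | inj₂ w = cong [ just , const nothing ]′ (splitAt-join n (t + k) (inj₂ (join t k (inj₁ w))))

-- Both graphs are G lifted along projections that reassociation identifies.
∪I-assoc : (G : Graph n) (t k : ℕ) → (G ∪I t) ∪I k ≅ G ∪I (t + k)
∪I-assoc {n} G t k = record { bij = assoc↔ {n} {t} {k} ; adj-bij = adj-assoc }
  where
  open Inverse (assoc↔ {n} {t} {k})
  open ≡-Reasoning
  adj-assoc : ∀ x y → adj (G ∪I (t + k)) (to x) (to y) ≡ adj ((G ∪I t) ∪I k) x y
  adj-assoc x y = begin
    adj (G ∪I (t + k)) (to x) (to y)
      ≡⟨ adj-∪I G (t + k) (to x) (to y) ⟩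
    adjᴹ G (old n (to x)) (old n (to y))
      ≡⟨ cong₂ (adjᴹ G) (old-assoc n t k x) (old-assoc n t k y) ⟩
    adjᴹ G (old (n + t) x >>= old n) (old (n + t) y >>= old n)
      ≡⟨ sym (adjᴹ-∪I G t (old (n + t) x) (old (n + t) y)) ⟩
    adjᴹ (G ∪I t) (old (n + t) x) (old (n + t) y)
      ≡⟨ sym (adj-∪I (G ∪I t) k x y) ⟩
    adj ((G ∪I t) ∪I k) x y
      ∎

compGraph-∪I-∪I : (G : Graph n) (t k : ℕ) →
                  IsCompGraphOfAcyclic ((G ∪I t) ∪I k) ⇔ IsCompGraphOfAcyclic (G ∪I (t + k))
compGraph-∪I-∪I G t k =
  mk⇔ (compGraph-≅ (∪I-assoc G t k)) (compGraph-≅ (≅-sym (∪I-assoc G t k)))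

competitionNumber-unique : {G : Graph n} {k k′ : ℕ} →
                           IsCompetitionNumber G k → IsCompetitionNumber G k′ → k ≡ k′
competitionNumber-unique (realised , minimal) (realised′ , minimal′) =
  ≤-antisym (minimal _ realised′) (minimal′ _ realised)

competitionNumber-∪I : (G : Graph n) → IsCompetitionNumber G k → t ≤ k →
                       IsCompetitionNumber (G ∪I t) (k ∸ t)
competitionNumber-∪I {k = k} {t = t} G (realised , minimal) t≤k = realised′ , minimal′
  where
  realised′ : IsCompGraphOfAcyclic ((G ∪I t) ∪I (k ∸ t))
  realised′ = Equivalence.from (compGraph-∪I-∪I G t (k ∸ t))
    (subst (λ s → IsCompGraphOfAcyclic (G ∪I s)) (sym (m+[n∸m]≡n t≤k)) realised)

  minimal′ : ∀ s → IsCompGraphOfAcyclic ((G ∪I t) ∪I s) → k ∸ t ≤ s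
  minimal′ s H = subst (k ∸ t ≤_) (m+n∸m≡n t s)
    (∸-monoˡ-≤ t (minimal (t + s) (Equivalence.to (compGraph-∪I-∪I G t s) H)))

module _ {n} (G : Graph n) (t : ℕ) where

  adj-↑ˡ : ∀ x y → adj (G ∪I t) (x ↑ˡ t) (y ↑ˡ t) ≡ adj G x y
  adj-↑ˡ x y = trans (adj-∪I G t (x ↑ˡ t) (y ↑ˡ t)) (cong₂ (adjᴹ G) (old-↑ˡ n x) (old-↑ˡ n y))

  edge-∪I : ∀ {i j} → Adj (G ∪I t) i j →
            ∃₂ λ x y → x ↑ˡ t ≡ i × y ↑ˡ t ≡ j × Adj G x y
  edge-∪I {i} {j} e with splitAt n i in ei | splitAt n j in ej
  ... | inj₁ x | inj₁ y = x , y , splitAt⁻¹-↑ˡ ei , splitAt⁻¹-↑ˡ ej , e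
  edge-∪I () | inj₁ _ | inj₂ _
  edge-∪I () | inj₂ _ | inj₁ _
  edge-∪I () | inj₂ _ | inj₂ _

  extend : (Fin n → Bool) → Fin (n + t) → Bool
  extend C i = [ C , const false ]′ (splitAt n i)

  extend-↑ˡ : ∀ C x → extend C (x ↑ˡ t) ≡ C x
  extend-↑ˡ C x = cong [ C , const false ]′ (splitAt-↑ˡ n x t)

  extend-true : ∀ C {i} → extend C i ≡ true → ∃ λ x → x ↑ˡ t ≡ i × C x ≡ true
  extend-true C {i} Ci with splitAt n i in ei
  ... | inj₁ x = x , splitAt⁻¹-↑ˡ ei , Ci
  extend-true C () | inj₂ _

  restrict : (Fin (n + t) → Bool) → Fin n → Bool
  restrict C x = C (x ↑ˡ t)

  extend-clique : ∀ C → IsClique G C → IsClique (G ∪I t) (extend C)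
  extend-clique C clique i j i≢j Ci Cj with extend-true C Ci | extend-true C Cj
  ... | x , refl , Cx | y , refl , Cy =
    trans (adj-↑ˡ x y) (clique x y (i≢j ∘ cong (_↑ˡ t)) Cx Cy)

  restrict-clique : ∀ C → IsClique (G ∪I t) C → IsClique G (restrict C)
  restrict-clique C clique x y x≢y Cx Cy =
    trans (sym (adj-↑ˡ x y)) (clique (x ↑ˡ t) (y ↑ˡ t) (x≢y ∘ ↑ˡ-injective t x y) Cx Cy)

  extend-cover : ∀ F → IsEdgeCliqueCover G F → IsEdgeCliqueCover (G ∪I t) (map extend F)
  extend-cover F (cliques , covers) =
    All.map⁺ (All.map (extend-clique _) cliques) , covers′
    where
    covers′ : ∀ i j → Adj (G ∪I t) i j → Any.Any (λ C → C i ≡ true × C j ≡ true) (map extend F)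
    covers′ i j e with edge-∪I e
    ... | x , y , refl , refl , exy = Any.map⁺ (Any.map lift (covers x y exy))
      where
      lift : ∀ {C} → C x ≡ true × C y ≡ true → extend C (x ↑ˡ t) ≡ true × extend C (y ↑ˡ t) ≡ true
      lift {C} (Cx , Cy) = trans (extend-↑ˡ C x) Cx , trans (extend-↑ˡ C y) Cy

  restrict-cover : ∀ F → IsEdgeCliqueCover (G ∪I t) F → IsEdgeCliqueCover G (map restrict F)
  restrict-cover F (cliques , covers) =
    All.map⁺ (All.map (restrict-clique _) cliques) ,
    λ x y e → Any.map⁺ (covers (x ↑ˡ t) (y ↑ˡ t) (trans (adj-↑ˡ x y) e))

  cliqueCoverNumber-∪I : ∀ {θ} → IsEdgeCliqueCoverNumber G θ → IsEdgeCliqueCoverNumber (G ∪I t) θ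
  cliqueCoverNumber-∪I {θ} ((F , cover , size) , minimal) =
    (map extend F , extend-cover F cover , trans (length-map extend F) size) ,
    λ F′ cover′ → subst (θ ≤_) (length-map restrict F′) (minimal _ (restrict-cover F′ cover′))

∸-+-shift : ∀ {k t} n → t ≤ k → (k ∸ t) + (n + t) ≡ k + n
∸-+-shift {k} {t} n t≤k = begin
  (k ∸ t) + (n + t) ≡⟨ cong ((k ∸ t) +_) (+-comm n t) ⟩
  (k ∸ t) + (t + n) ≡⟨ sym (+-assoc (k ∸ t) t n) ⟩
  (k ∸ t) + t + n   ≡⟨ cong (_+ n) (m∸n+n≡m t≤k) ⟩
  k + n             ∎
  where open ≡-Reasoning

mainTheorem5 : ∀ {n} (G : Graph n) → CompetitivelyTight G →
    ∀ (k t : ℕ) → IsCompetitionNumber G k → t ≤ k →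
    CompetitivelyTight (G ∪I t)
mainTheorem5 {n} G (k₀ , θ , k₀-number , θ-number , tight) k t k-number t≤k =
  k ∸ t , θ ,
  competitionNumber-∪I G k-number t≤k ,
  cliqueCoverNumber-∪I G t θ-number ,
  (begin
    (k ∸ t) + (n + t) ≡⟨ ∸-+-shift n t≤k ⟩
    k + n             ≡⟨ cong (_+ n) (competitionNumber-unique {G = G} k-number k₀-number) ⟩
    k₀ + n            ≡⟨ tight ⟩
    θ + 2             ∎)
  where open ≡-Reasoning
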